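{- Let $k\ge 0$ be an integer, let $p_1,\dots,p_k$ be distinct primes, and let $\Gamma_k$ be the $k$-dprime divisor function graph of $n=p_1p_2\cdots p_k$. Then the first Zagreb index of $\Gamma_k$ is $$M_1(\Gamma_k)=2(2^k-1)^2+\sum_{j=1}^{k-1}\binom{k}{j}\bigl(2^j+2^{k-j}-2\bigr)^2.$$
   Context: For $n=p_1p_2\cdots p_k$ with $p_1,\dots,p_k$ distinct primes, the $k$-dprime divisor function graph $\Gamma_k=G_{D(n)}$ is the simple graph with vertex set $V(\Gamma_k)=\{u\in\mathbb{Z}_{>0}: u\mid n\}$ and edge set $E(\Gamma_k)=\{uv: u\neq v,\ u\mid v \text{ or } v\mid u\}$. The first Zagreb index is $M_1(\Gamma_k)=\sum_{u\in V(\Gamma_k)}\deg_{\Gamma_k}(u)^2$. -}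

module Defs where

open import Data.Nat using (ℕ; zero; suc; _+_; _*_; _∸_; _^_; _≟_)
open import Data.Nat.Divisibility using (_∣_; _∣?_)
open import Data.Nat.Combinatorics using (_C_)
open import Data.List using (List; []; _∷_; filter; map; length; applyUpTo)
open import Data.Nat.ListAction using (sum)
open import Data.Vec using (Vec; foldr)
open import Data.Product using (_×_)
open import Data.Sum using (_⊎_)
open import Relation.Nullary using (¬_; Dec; yes; no)
open import Relation.Nullary.Decidable using (_×-dec_; _⊎-dec_; ¬?)

divisors : ℕ → List ℕ
divisors n = filter (λ u → u ∣? n) (applyUpTo suc n)

Adj : ℕ → ℕ → Set
Adj u v = ¬ (u ≡ v) × (u ∣ v ⊎ v ∣ u)
  where open import Relation.Binary.PropositionalEquality using (_≡_)

adj? : (u v : ℕ) → Dec (Adj u v)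
adj? u v = ¬? (u ≟ v) ×-dec ((u ∣? v) ⊎-dec (v ∣? u))

degree : ℕ → ℕ → ℕ
degree n u = length (filter (adj? u) (divisors n))

M₁ : ℕ → ℕ
M₁ n = sum (map (λ u → degree n u * degree n u) (divisors n))

-- Σ_{j=a}^{b} f j  (empty when b < a).
sumFromTo : ℕ → ℕ → (ℕ → ℕ) → ℕ
sumFromTo a b f = sum (applyUpTo (λ i → f (a + i)) (suc b ∸ a))

prodVec : ∀ {k} → Vec ℕ k → ℕ
prodVec = foldr _ _*_ 1

-- For a vertex u of a divisor graph record its profile: its degree, the number of its
-- divisors and the number of its multiples in the graph (u itself counted in both).
-- Adjoining a new prime q to n splits D(qn) into D(n) and q·D(n).  A vertex u ∈ D(n)
-- keeps its divisors, doubles its multiples and gains its old multiples as neighbours;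
-- the vertex qu doubles its divisors, keeps its multiples and gains the old divisors of
-- u as neighbours.  By induction on k, a divisor of p₁⋯p_k with j prime factors has
-- profile (2^j + 2^(k-j) - 2, 2^j, 2^(k-j)), and there are C(k,j) of them; the recursion
-- on the counts is Pascal's rule.  Summing deg² over the ranks gives M₁, the ranks 0 and
-- k contributing the same term (2^k - 1)².
module Submission where

open import Defs
open import Data.Nat using (ℕ; zero; suc; _+_; _*_; _∸_; _^_; _≤_; _<_; s≤s; s≤s⁻¹; z≤n; NonZero; ≢-nonZero⁻¹)
open import Data.Nat.Properties
open import Data.Nat.Divisibility
open import Data.Nat.Coprimality using (Coprime; coprime-divisor)
open import Data.Nat.Primality using (Prime; prime⇒irreducible; prime⇒nonZero; euclidsLemma; ¬prime[1])
open import Data.Nat.Combinatorics using (_C_; nCk+nC[k+1]≡[n+1]C[k+1]; k>n⇒nCk≡0; nCn≡1)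
open import Data.Nat.Tactic.RingSolver using (solve-∀)
open import Data.Nat.ListAction using (sum)
open import Data.Nat.ListAction.Properties using (sum-↭; sum-++)
open import Data.Vec using (Vec; []; _∷_; lookup)
open import Data.Fin using (zero; suc)
import Data.Fin.Properties as Fin
open import Data.List using (List; []; _∷_; _++_; map; filter; length; applyUpTo)
open import Data.List.Properties using (map-++; map-∘; map-id; map-cong; map-cong-local; filter-++; filter-none; length-++)
open import Data.List.Membership.Propositional using (_∈_)
open import Data.List.Membership.Propositional.Properties
  using (∈-filter⁺; ∈-filter⁻; ∈-applyUpTo⁺; ∈-map⁺; ∈-map⁻; ∈-++⁺ˡ; ∈-++⁺ʳ; ∈-++⁻)
open import Data.List.Membership.Propositional.Properties.WithK using (unique∧set⇒bag)
open import Data.List.Relation.Binary.BagAndSetEquality using (∼bag⇒↭)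
open import Data.List.Relation.Binary.Permutation.Propositional using (_↭_)
import Data.List.Relation.Binary.Permutation.Propositional.Properties as Perm
open import Data.List.Relation.Unary.All as All using (All)
open import Data.List.Relation.Unary.Any using (here; there)
open import Data.List.Relation.Unary.Unique.Propositional using (Unique)
import Data.List.Relation.Unary.Unique.Propositional.Properties as Unique
open import Data.Product using (_,_; proj₂)
open import Data.Sum using (inj₁; inj₂)
open import Data.Empty using (⊥; ⊥-elim)
open import Function using (_∘_; _⇔_; mk⇔; Equivalence)
open import Relation.Nullary using (¬_; yes; no)
open import Relation.Unary using (Pred; Decidable)
open import Level using (0ℓ)
open import Relation.Binary.PropositionalEquality
  using (_≡_; refl; sym; trans; cong; cong₂; subst; module ≡-Reasoning)

open Equivalence using (to; from)

cong₃ : ∀ (g : ℕ → ℕ → ℕ → ℕ) {a a′ b b′ c c′} → a ≡ a′ → b ≡ b′ → c ≡ c′ → g a b c ≡ g a′ b′ c′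
cong₃ g refl refl refl = refl

sumBelow : ℕ → (ℕ → ℕ) → ℕ
sumBelow zero    h = 0
sumBelow (suc n) h = h 0 + sumBelow n (λ j → h (suc j))

infix 8 sumBelow
syntax sumBelow n (λ j → e) = ∑[ j < n ] e

sum-applyUpTo : ∀ n (h : ℕ → ℕ) → sum (applyUpTo h n) ≡ ∑[ j < n ] h j
sum-applyUpTo zero    h = refl
sum-applyUpTo (suc n) h = cong (h 0 +_) (sum-applyUpTo n (λ j → h (suc j)))

∑-last : ∀ n (h : ℕ → ℕ) → ∑[ j < suc n ] h j ≡ ∑[ j < n ] h j + h n
∑-last zero    h = +-identityʳ (h 0)
∑-last (suc n) h = trans (cong (h 0 +_) (∑-last n (λ j → h (suc j)))) (sym (+-assoc (h 0) _ _))

∑-+ : ∀ n (g h : ℕ → ℕ) → ∑[ j < n ] (g j + h j) ≡ ∑[ j < n ] g j + ∑[ j < n ] h j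
∑-+ zero    g h = refl
∑-+ (suc n) g h = trans (cong (g 0 + h 0 +_) (∑-+ n (λ j → g (suc j)) (λ j → h (suc j)))) (interchange (g 0) (h 0) _ _)
  where
  interchange : ∀ a b c d → (a + b) + (c + d) ≡ (a + c) + (b + d)
  interchange = solve-∀

∑-cong : ∀ n {g h : ℕ → ℕ} → (∀ j → j < n → g j ≡ h j) → ∑[ j < n ] g j ≡ ∑[ j < n ] h j
∑-cong zero    e = refl
∑-cong (suc n) e = cong₂ _+_ (e 0 (s≤s z≤n)) (∑-cong n (λ j j<n → e (suc j) (s≤s j<n)))

nC0≡1 : ∀ n → n C 0 ≡ 1
nC0≡1 zero    = refl
nC0≡1 (suc n) = refl

∑-binomial-pascal : ∀ k (G : ℕ → ℕ) →
  ∑[ j < suc (suc k) ] ((suc k C j) * G j)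
    ≡ ∑[ j < suc k ] ((k C j) * G j) + ∑[ j < suc k ] ((k C j) * G (suc j))
∑-binomial-pascal k G = begin
  1 * G 0 + ∑[ j < suc k ] ((suc k C suc j) * G (suc j))
    ≡⟨ cong (1 * G 0 +_) (∑-cong (suc k) (λ j _ → pascal j)) ⟩
  1 * G 0 + ∑[ j < suc k ] ((k C j) * G (suc j) + (k C suc j) * G (suc j))
    ≡⟨ cong (1 * G 0 +_) (∑-+ (suc k) (λ j → (k C j) * G (suc j)) (λ j → (k C suc j) * G (suc j))) ⟩
  1 * G 0 + (A + ∑[ j < suc k ] ((k C suc j) * G (suc j)))
    ≡⟨ cong (λ z → 1 * G 0 + (A + z)) (∑-last k (λ j → (k C suc j) * G (suc j))) ⟩
  1 * G 0 + (A + (B + (k C suc k) * G (suc k)))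
    ≡⟨ cong (λ z → 1 * G 0 + (A + (B + z * G (suc k)))) (k>n⇒nCk≡0 (n<1+n k)) ⟩
  1 * G 0 + (A + (B + 0))
    ≡⟨ rearrange (G 0) A B ⟩
  (1 * G 0 + B) + A
    ≡⟨ cong (λ z → (z * G 0 + B) + A) (sym (nC0≡1 k)) ⟩
  ((k C 0) * G 0 + B) + A ∎
  where
  open ≡-Reasoning
  A = ∑[ j < suc k ] ((k C j) * G (suc j))
  B = ∑[ j < k ] ((k C suc j) * G (suc j))
  pascal : ∀ j → (suc k C suc j) * G (suc j) ≡ (k C j) * G (suc j) + (k C suc j) * G (suc j)
  pascal j = trans (cong (_* G (suc j)) (sym (nCk+nC[k+1]≡[n+1]C[k+1] k j)))
                   (*-distribʳ-+ (G (suc j)) (k C j) (k C suc j))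
  rearrange : ∀ x a b → 1 * x + (a + (b + 0)) ≡ (1 * x + b) + a
  rearrange = solve-∀

module _ {P Q : Pred ℕ 0ℓ} (P? : Decidable P) (Q? : Decidable Q) where

  length-filter-map-local : ∀ (f : ℕ → ℕ) xs → (∀ {x} → x ∈ xs → P (f x) ⇔ Q x) →
    length (filter P? (map f xs)) ≡ length (filter Q? xs)
  length-filter-map-local f []       h = refl
  length-filter-map-local f (x ∷ xs) h with P? (f x) | Q? x
  ... | yes _  | yes _  = cong suc (length-filter-map-local f xs (h ∘ there))
  ... | no _   | no _   = length-filter-map-local f xs (h ∘ there)
  ... | yes p  | no ¬q  = ⊥-elim (¬q (to (h (here refl)) p))
  ... | no ¬p  | yes q  = ⊥-elim (¬p (from (h (here refl)) q))

  length-filter-local : ∀ xs → (∀ {x} → x ∈ xs → P x ⇔ Q x) →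
    length (filter P? xs) ≡ length (filter Q? xs)
  length-filter-local xs h =
    trans (cong (length ∘ filter P?) (sym (map-id xs)))
          (length-filter-map-local (λ x → x) xs h)

module _ {P : Pred ℕ 0ℓ} (P? : Decidable P) where

  length-filter-++ : ∀ xs ys → length (filter P? (xs ++ ys)) ≡ length (filter P? xs) + length (filter P? ys)
  length-filter-++ xs ys = trans (cong length (filter-++ P? xs ys)) (length-++ (filter P? xs))

  length-filter-none : ∀ xs → (∀ {x} → x ∈ xs → ¬ P x) → length (filter P? xs) ≡ 0
  length-filter-none xs h = cong length (filter-none P? (All.tabulate h))

sum-map-cong-local : ∀ xs {g h : ℕ → ℕ} → (∀ {x} → x ∈ xs → g x ≡ h x) → sum (map g xs) ≡ sum (map h xs)
sum-map-cong-local xs e = cong sum (map-cong-local (All.tabulate e))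

∈-divisors⁻ : ∀ {m u} → u ∈ divisors m → u ∣ m
∈-divisors⁻ {m} h = proj₂ (∈-filter⁻ (_∣? m) {xs = applyUpTo suc m} h)

∈-divisors⁺ : ∀ {m u} → .{{NonZero m}} → u ∣ m → u ∈ divisors m
∈-divisors⁺ {m} {zero}  d = ⊥-elim (≢-nonZero⁻¹ m (0∣⇒≡0 d))
∈-divisors⁺ {m} {suc i} d = ∈-filter⁺ (_∣? m) (∈-applyUpTo⁺ suc (∣⇒≤ d)) d

divisors-unique : ∀ m → Unique (divisors m)
divisors-unique m = Unique.filter⁺ (_∣? m)
  (Unique.applyUpTo⁺₁ suc m (λ i<j _ eq → <⇒≢ i<j (suc-injective eq)))

module _ {q : ℕ} (q-prime : Prime q) where

  private instance
    q≢0 : NonZero q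
    q≢0 = prime⇒nonZero q-prime

  ∤⇒coprime : ∀ {u} → ¬ q ∣ u → Coprime u q
  ∤⇒coprime q∤u (d∣u , d∣q) with prime⇒irreducible q-prime d∣q
  ... | inj₁ d≡1 = d≡1
  ... | inj₂ refl = ⊥-elim (q∤u d∣u)

  q*∤ : ∀ {u w} → ¬ q ∣ u → ¬ q * w ∣ u
  q*∤ q∤u d = q∤u (∣-trans (m∣m*n _) d)

  ∣-q*⇔∣ : ∀ {u w} → ¬ q ∣ u → u ∣ q * w ⇔ u ∣ w
  ∣-q*⇔∣ q∤u = mk⇔ (coprime-divisor (∤⇒coprime q∤u)) (λ d → ∣-trans d (n∣m*n q))

  q*∣q*⇔∣ : ∀ {u w} → q * u ∣ q * w ⇔ u ∣ w
  q*∣q*⇔∣ = mk⇔ (*-cancelˡ-∣ q) (*-monoʳ-∣ q)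

  Adj-q*ʳ⇔∣ : ∀ {u w} → ¬ q ∣ u → Adj u (q * w) ⇔ u ∣ w
  Adj-q*ʳ⇔∣ q∤u = mk⇔
    (λ { (_ , inj₁ d) → to (∣-q*⇔∣ q∤u) d ; (_ , inj₂ d) → ⊥-elim (q*∤ q∤u d) })
    (λ d → (λ eq → q∤u (subst (q ∣_) (sym eq) (m∣m*n _))) , inj₁ (∣-trans d (n∣m*n q)))

  Adj-q*ˡ⇔∣ : ∀ {u w} → ¬ q ∣ w → Adj (q * u) w ⇔ w ∣ u
  Adj-q*ˡ⇔∣ q∤w = mk⇔
    (λ { (_ , inj₁ d) → ⊥-elim (q*∤ q∤w d) ; (_ , inj₂ d) → to (∣-q*⇔∣ q∤w) d })
    (λ d → (λ eq → q∤w (subst (q ∣_) eq (m∣m*n _))) , inj₂ (∣-trans d (n∣m*n q)))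

  Adj-q*⇔Adj : ∀ {u w} → Adj (q * u) (q * w) ⇔ Adj u w
  Adj-q*⇔Adj = mk⇔
    (λ { (ne , inj₁ d) → (ne ∘ cong (q *_)) , inj₁ (*-cancelˡ-∣ q d)
       ; (ne , inj₂ d) → (ne ∘ cong (q *_)) , inj₂ (*-cancelˡ-∣ q d) })
    (λ { (ne , inj₁ d) → (ne ∘ *-cancelˡ-≡ _ _ q) , inj₁ (*-monoʳ-∣ q d)
       ; (ne , inj₂ d) → (ne ∘ *-cancelˡ-≡ _ _ q) , inj₂ (*-monoʳ-∣ q d) })

degreeIn #divisorsIn #multiplesIn : List ℕ → ℕ → ℕ
degreeIn    X u = length (filter (adj? u) X)
#divisorsIn  X u = length (filter (_∣? u) X)
#multiplesIn X u = length (filter (u ∣?_) X)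

profileSum : (ℕ → ℕ → ℕ → ℕ) → List ℕ → ℕ
profileSum f X = sum (map (λ u → f (degreeIn X u) (#divisorsIn X u) (#multiplesIn X u)) X)

profileSum-↭ : ∀ f {X Y} → X ↭ Y → profileSum f X ≡ profileSum f Y
profileSum-↭ f {X} {Y} X↭Y = begin
  sum (map (profile X) X) ≡⟨ sum-↭ (Perm.map⁺ (profile X) X↭Y) ⟩
  sum (map (profile X) Y) ≡⟨ cong sum (map-cong (λ u → cong₃ f (count (adj? u)) (count (_∣? u)) (count (u ∣?_))) Y) ⟩
  sum (map (profile Y) Y) ∎
  where
  open ≡-Reasoning
  profile : List ℕ → ℕ → ℕ
  profile Z u = f (degreeIn Z u) (#divisorsIn Z u) (#multiplesIn Z u)
  count : ∀ {P : Pred ℕ 0ℓ} (P? : Decidable P) → length (filter P? X) ≡ length (filter P? Y)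
  count P? = Perm.↭-length (Perm.filter-↭ P? X↭Y)

module Extension {q : ℕ} (q-prime : Prime q) (n : ℕ) .{{n≢0 : NonZero n}} (q∤n : ¬ q ∣ n) where

  private instance
    q≢0 : NonZero q
    q≢0 = prime⇒nonZero q-prime
    qn≢0 : NonZero (q * n)
    qn≢0 = m*n≢0 q n

  D qD : List ℕ
  D  = divisors n
  qD = map (q *_) D

  ∤-divisor : ∀ {u} → u ∈ D → ¬ q ∣ u
  ∤-divisor u∈D q∣u = q∤n (∣-trans q∣u (∈-divisors⁻ u∈D))

  divisors-split : divisors (q * n) ↭ D ++ qD
  divisors-split = ∼bag⇒↭ (unique∧set⇒bag (divisors-unique (q * n)) unique-split (mk⇔ split merge))
    where
    split : ∀ {x} → x ∈ divisors (q * n) → x ∈ D ++ qD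
    split {x} x∣qn with q ∣? x
    ... | yes (divides c refl) = ∈-++⁺ʳ D (subst (_∈ qD) (*-comm q c)
            (∈-map⁺ (q *_) (∈-divisors⁺ (*-cancelˡ-∣ q (subst (_∣ q * n) (*-comm c q) (∈-divisors⁻ x∣qn))))))
    ... | no q∤x = ∈-++⁺ˡ (∈-divisors⁺ (to (∣-q*⇔∣ q-prime q∤x) (∈-divisors⁻ x∣qn)))
    merge : ∀ {x} → x ∈ D ++ qD → x ∈ divisors (q * n)
    merge x∈ with ∈-++⁻ D x∈
    ... | inj₁ x∈D = ∈-divisors⁺ (∣-trans (∈-divisors⁻ x∈D) (n∣m*n q))
    ... | inj₂ x∈qD with ∈-map⁻ (q *_) x∈qD
    ... | c , c∈D , refl = ∈-divisors⁺ (*-monoʳ-∣ q (∈-divisors⁻ c∈D))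
    unique-split : Unique (D ++ qD)
    unique-split = Unique.++⁺ (divisors-unique n) (Unique.map⁺ (*-cancelˡ-≡ _ _ q) (divisors-unique n))
      λ { (v∈D , v∈qD) → disjoint v∈D v∈qD }
      where
      disjoint : ∀ {v} → v ∈ D → v ∈ qD → ⊥
      disjoint v∈D v∈qD with ∈-map⁻ (q *_) v∈qD
      ... | c , _ , refl = ∤-divisor v∈D (m∣m*n c)

  module _ {u : ℕ} (u∈D : u ∈ D) where

    q∤u : ¬ q ∣ u
    q∤u = ∤-divisor u∈D

    degreeIn-lower : degreeIn (D ++ qD) u ≡ degreeIn D u + #multiplesIn D u
    degreeIn-lower = trans (length-filter-++ (adj? u) D qD)
      (cong (degreeIn D u +_)
        (length-filter-map-local (adj? u) (u ∣?_) (q *_) D (λ _ → Adj-q*ʳ⇔∣ q-prime q∤u)))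

    #divisorsIn-lower : #divisorsIn (D ++ qD) u ≡ #divisorsIn D u
    #divisorsIn-lower = trans (length-filter-++ (_∣? u) D qD)
      (trans (cong (#divisorsIn D u +_) (length-filter-none (_∣? u) qD qv∤u)) (+-identityʳ _))
      where
      qv∤u : ∀ {x} → x ∈ qD → ¬ x ∣ u
      qv∤u x∈qD with ∈-map⁻ (q *_) x∈qD
      ... | _ , _ , refl = q*∤ q-prime q∤u

    #multiplesIn-lower : #multiplesIn (D ++ qD) u ≡ #multiplesIn D u + #multiplesIn D u
    #multiplesIn-lower = trans (length-filter-++ (u ∣?_) D qD)
      (cong (#multiplesIn D u +_)
        (length-filter-map-local (u ∣?_) (u ∣?_) (q *_) D (λ _ → ∣-q*⇔∣ q-prime q∤u)))

    degreeIn-upper : degreeIn (D ++ qD) (q * u) ≡ #divisorsIn D u + degreeIn D u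
    degreeIn-upper = trans (length-filter-++ (adj? (q * u)) D qD)
      (cong₂ _+_
        (length-filter-local (adj? (q * u)) (_∣? u) D (λ w∈D → Adj-q*ˡ⇔∣ q-prime (∤-divisor w∈D)))
        (length-filter-map-local (adj? (q * u)) (adj? u) (q *_) D (λ _ → Adj-q*⇔Adj q-prime)))

    #divisorsIn-upper : #divisorsIn (D ++ qD) (q * u) ≡ #divisorsIn D u + #divisorsIn D u
    #divisorsIn-upper = trans (length-filter-++ (_∣? q * u) D qD)
      (cong₂ _+_
        (length-filter-local (_∣? q * u) (_∣? u) D (λ w∈D → ∣-q*⇔∣ q-prime (∤-divisor w∈D)))
        (length-filter-map-local (_∣? q * u) (_∣? u) (q *_) D (λ _ → q*∣q*⇔∣ q-prime)))

    #multiplesIn-upper : #multiplesIn (D ++ qD) (q * u) ≡ #multiplesIn D u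
    #multiplesIn-upper = trans (length-filter-++ ((q * u) ∣?_) D qD)
      (cong₂ _+_
        (length-filter-none ((q * u) ∣?_) D (λ w∈D → q*∤ q-prime (∤-divisor w∈D)))
        (length-filter-map-local ((q * u) ∣?_) (u ∣?_) (q *_) D (λ _ → q*∣q*⇔∣ q-prime)))

  profileSum-extend : ∀ f →
    profileSum f (divisors (q * n))
      ≡ profileSum (λ d a b → f (d + b) a (b + b)) D + profileSum (λ d a b → f (a + d) (a + a) b) D
  profileSum-extend f = begin
    profileSum f (divisors (q * n))
      ≡⟨ profileSum-↭ f divisors-split ⟩
    sum (map profile (D ++ qD))
      ≡⟨ cong sum (map-++ profile D qD) ⟩
    sum (map profile D ++ map profile qD)
      ≡⟨ sum-++ (map profile D) _ ⟩
    sum (map profile D) + sum (map profile qD)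
      ≡⟨ cong (λ xs → sum (map profile D) + sum xs) (sym (map-∘ D)) ⟩
    sum (map profile D) + sum (map (profile ∘ (q *_)) D)
      ≡⟨ cong₂ _+_
           (sum-map-cong-local D (λ u∈D → cong₃ f (degreeIn-lower u∈D) (#divisorsIn-lower u∈D) (#multiplesIn-lower u∈D)))
           (sum-map-cong-local D (λ u∈D → cong₃ f (degreeIn-upper u∈D) (#divisorsIn-upper u∈D) (#multiplesIn-upper u∈D))) ⟩
    profileSum (λ d a b → f (d + b) a (b + b)) D + profileSum (λ d a b → f (a + d) (a + a) b) D ∎
    where
    open ≡-Reasoning
    profile : ℕ → ℕ
    profile u = f (degreeIn (D ++ qD) u) (#divisorsIn (D ++ qD) u) (#multiplesIn (D ++ qD) u)

open Extension using (profileSum-extend)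

prodVec-nonZero : ∀ {k} (p : Vec ℕ k) → (∀ i → Prime (lookup p i)) → NonZero (prodVec p)
prodVec-nonZero []      _     = _
prodVec-nonZero (r ∷ p) prime =
  m*n≢0 r (prodVec p) {{prime⇒nonZero (prime zero)}} {{prodVec-nonZero p (prime ∘ suc)}}

prime∤prodVec : ∀ {q k} (p : Vec ℕ k) → Prime q → (∀ i → Prime (lookup p i)) →
  (∀ i → ¬ q ≡ lookup p i) → ¬ q ∣ prodVec p
prime∤prodVec [] q-prime _ _ q∣1 with ∣1⇒≡1 q∣1
... | refl = ¬prime[1] q-prime
prime∤prodVec (r ∷ p) q-prime prime q≢p q∣rp with euclidsLemma r (prodVec p) q-prime q∣rp
... | inj₂ q∣p = prime∤prodVec p q-prime (prime ∘ suc) (q≢p ∘ suc) q∣p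
... | inj₁ q∣r with prime⇒irreducible (prime zero) q∣r
...   | inj₁ refl = ¬prime[1] q-prime
...   | inj₂ q≡r  = q≢p zero q≡r

-- The truncated subtraction never truncates: 2 ^ j + 2 ^ (k ∸ j) ≥ 2.
rankDegree : ℕ → ℕ → ℕ
rankDegree k j = 2 ^ j + 2 ^ (k ∸ j) ∸ 2

2≤2^j+2^i : ∀ j i → 2 ≤ 2 ^ j + 2 ^ i
2≤2^j+2^i j i = +-mono-≤ (m^n>0 2 j) (m^n>0 2 i)

2^j-double : ∀ j → 2 ^ j + 2 ^ j ≡ 2 ^ suc j
2^j-double j = double (2 ^ j)
  where
  double : ∀ a → a + a ≡ 2 * a
  double = solve-∀

2^[k∸j]-double : ∀ {k j} → j ≤ k → 2 ^ (k ∸ j) + 2 ^ (k ∸ j) ≡ 2 ^ (suc k ∸ j)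
2^[k∸j]-double {k} {j} j≤k = trans (2^j-double (k ∸ j)) (cong (2 ^_) (sym (+-∸-assoc 1 j≤k)))

rankDegree-lower : ∀ {k j} → j ≤ k → rankDegree k j + 2 ^ (k ∸ j) ≡ rankDegree (suc k) j
rankDegree-lower {k} {j} j≤k = begin
  (2 ^ j + b ∸ 2) + b ≡⟨ sym (+-∸-comm b (2≤2^j+2^i j (k ∸ j))) ⟩
  (2 ^ j + b + b) ∸ 2 ≡⟨ cong (_∸ 2) (+-assoc (2 ^ j) b b) ⟩
  2 ^ j + (b + b) ∸ 2 ≡⟨ cong (λ c → 2 ^ j + c ∸ 2) (2^[k∸j]-double j≤k) ⟩
  rankDegree (suc k) j ∎
  where
  open ≡-Reasoning
  b : ℕ
  b = 2 ^ (k ∸ j)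

rankDegree-upper : ∀ k j → 2 ^ j + rankDegree k j ≡ rankDegree (suc k) (suc j)
rankDegree-upper k j = begin
  2 ^ j + (2 ^ j + b ∸ 2) ≡⟨ sym (+-∸-assoc (2 ^ j) (2≤2^j+2^i j (k ∸ j))) ⟩
  2 ^ j + (2 ^ j + b) ∸ 2 ≡⟨ cong (_∸ 2) (sym (+-assoc (2 ^ j) (2 ^ j) b)) ⟩
  2 ^ j + 2 ^ j + b ∸ 2   ≡⟨ cong (λ c → c + b ∸ 2) (2^j-double j) ⟩
  rankDegree (suc k) (suc j) ∎
  where
  open ≡-Reasoning
  b : ℕ
  b = 2 ^ (k ∸ j)

profileSum-squarefree : ∀ k (p : Vec ℕ k) → (∀ i → Prime (lookup p i)) →
  (∀ i j → lookup p i ≡ lookup p j → i ≡ j) → ∀ f →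
  profileSum f (divisors (prodVec p)) ≡ ∑[ j < suc k ] ((k C j) * f (rankDegree k j) (2 ^ j) (2 ^ (k ∸ j)))
profileSum-squarefree zero    []      _     _        f = sym (+-identityʳ _)
profileSum-squarefree (suc k) (q ∷ p) prime distinct f = begin
  profileSum f (divisors (q * prodVec p))
    ≡⟨ profileSum-extend (prime zero) (prodVec p) q∤p f ⟩
  profileSum (λ d a b → f (d + b) a (b + b)) (divisors (prodVec p))
    + profileSum (λ d a b → f (a + d) (a + a) b) (divisors (prodVec p))
    ≡⟨ cong₂ _+_ (profileSum-squarefree k p prime′ distinct′ (λ d a b → f (d + b) a (b + b)))
                 (profileSum-squarefree k p prime′ distinct′ (λ d a b → f (a + d) (a + a) b)) ⟩
  ∑[ j < suc k ] ((k C j) * f (rankDegree k j + 2 ^ (k ∸ j)) (2 ^ j) (2 ^ (k ∸ j) + 2 ^ (k ∸ j)))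
    + ∑[ j < suc k ] ((k C j) * f (2 ^ j + rankDegree k j) (2 ^ j + 2 ^ j) (2 ^ (k ∸ j)))
    ≡⟨ cong₂ _+_ (∑-cong (suc k) (λ j j≤k → cong ((k C j) *_) (lower (s≤s⁻¹ j≤k))))
                 (∑-cong (suc k) (λ j _ → cong ((k C j) *_) (upper j))) ⟩
  ∑[ j < suc k ] ((k C j) * G j) + ∑[ j < suc k ] ((k C j) * G (suc j))
    ≡⟨ sym (∑-binomial-pascal k G) ⟩
  ∑[ j < suc (suc k) ] ((suc k C j) * G j) ∎
  where
  open ≡-Reasoning
  prime′ : ∀ i → Prime (lookup p i)
  prime′ = prime ∘ suc
  distinct′ : ∀ i j → lookup p i ≡ lookup p j → i ≡ j
  distinct′ i j eq = Fin.suc-injective (distinct (suc i) (suc j) eq)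
  instance
    p≢0 : NonZero (prodVec p)
    p≢0 = prodVec-nonZero p prime′
  q∤p : ¬ q ∣ prodVec p
  q∤p = prime∤prodVec p (prime zero) prime′ (λ i → Fin.0≢1+n ∘ distinct zero (suc i))
  G : ℕ → ℕ
  G j = f (rankDegree (suc k) j) (2 ^ j) (2 ^ (suc k ∸ j))
  lower : ∀ {j} → j ≤ k → f (rankDegree k j + 2 ^ (k ∸ j)) (2 ^ j) (2 ^ (k ∸ j) + 2 ^ (k ∸ j)) ≡ G j
  lower j≤k = cong₃ f (rankDegree-lower j≤k) refl (2^[k∸j]-double j≤k)
  upper : ∀ j → f (2 ^ j + rankDegree k j) (2 ^ j + 2 ^ j) (2 ^ (k ∸ j)) ≡ G (suc j)
  upper j = cong₃ f (rankDegree-upper k j) (2^j-double j) refl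

-- The j = 0 term is (2^k - 1)² by computation (1 + 2^k ∸ 2 reduces to 2^k ∸ 1), and so is the j = k term.
∑-binomial-rankDegree² : ∀ k →
  ∑[ j < suc k ] ((k C j) * (rankDegree k j * rankDegree k j))
    ≡ 2 * ((2 ^ k ∸ 1) * (2 ^ k ∸ 1))
      + sumFromTo 1 (k ∸ 1) (λ j → (k C j) * ((2 ^ j + 2 ^ (k ∸ j) ∸ 2) * (2 ^ j + 2 ^ (k ∸ j) ∸ 2)))
∑-binomial-rankDegree² zero    = refl
∑-binomial-rankDegree² (suc m) = begin
  1 * (X * X) + ∑[ j < suc m ] h (suc j)
    ≡⟨ cong (1 * (X * X) +_) (∑-last m (λ j → h (suc j))) ⟩
  1 * (X * X) + (∑[ j < m ] h (suc j) + h k)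
    ≡⟨ cong (λ z → 1 * (X * X) + (∑[ j < m ] h (suc j) + z)) last ⟩
  1 * (X * X) + (∑[ j < m ] h (suc j) + X * X)
    ≡⟨ rearrange (X * X) _ ⟩
  2 * (X * X) + ∑[ j < m ] h (suc j)
    ≡⟨ cong (2 * (X * X) +_) (sym (sum-applyUpTo m (λ j → h (suc j)))) ⟩
  2 * (X * X) + sumFromTo 1 (k ∸ 1) h ∎
  where
  open ≡-Reasoning
  k X : ℕ
  k = suc m
  X = 2 ^ k ∸ 1
  h : ℕ → ℕ
  h j = (k C j) * (rankDegree k j * rankDegree k j)
  rankDegree-top : rankDegree k k ≡ X
  rankDegree-top = trans (cong (λ i → 2 ^ k + 2 ^ i ∸ 2) (n∸n≡0 k)) (cong (_∸ 2) (+-comm (2 ^ k) 1))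
  last : h k ≡ X * X
  last = trans (cong₂ (λ c r → c * (r * r)) (nCn≡1 k) rankDegree-top) (*-identityˡ (X * X))
  rearrange : ∀ y a → 1 * y + (a + y) ≡ 2 * y + a
  rearrange = solve-∀

theorem3p7 : (k : ℕ) (p : Vec ℕ k) →
    (∀ i → Prime (lookup p i)) →
    (∀ i j → lookup p i ≡ lookup p j → i ≡ j) →
    M₁ (prodVec p)
      ≡ 2 * ((2 ^ k ∸ 1) * (2 ^ k ∸ 1))
        + sumFromTo 1 (k ∸ 1) (λ j → (k C j) * ((2 ^ j + 2 ^ (k ∸ j) ∸ 2) * (2 ^ j + 2 ^ (k ∸ j) ∸ 2)))
theorem3p7 k p prime distinct =
  trans (profileSum-squarefree k p prime distinct (λ d _ _ → d * d)) (∑-binomial-rankDegree² k)
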